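{- For integers $0\le d\le n$ define $$g_{n,d}(t)=\sum_{i=1}^{\min(d,n-d)} \frac{(n-i-1)!}{(d-i)!\,(n-d-i)!\,(i-1)!}\, t^i .$$ Then for every integer $d\ge 2$, $$g_{2d,d}(t)=\frac{(d-1)t}{dt+1}\, g_{2d-1,d-1}(t)+\frac{t(t+1)}{dt+1}\, g_{2d,d}'(t),$$ $$g_{2d,d}(t)=\frac{(2d-1)t+2d}{dt+d+1}\, g_{2d-1,d-1}(t)+\frac{t(t+1)^2}{(d-1)(dt+d+1)}\, g_{2d,d}''(t),$$ and for every integer $d\ge 1$, $$g_{2d+1,d}(t)=\frac{dt}{(d+1)t+1}\, g_{2d,d}(t)+\frac{t(t+1)}{(d+1)t+1}\, g_{2d+1,d}'(t),$$ $$g_{2d+1,d}(t)=\frac{2dt+2d+1}{(d+1)t+d+2}\, g_{2d,d}(t)+\frac{t(t+1)^2}{d(dt+t+d+2)}\, g_{2d+1,d}''(t).$$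
   Context: $g_{n,d}$ is Speyer's $g$-polynomial of the uniform matroid $U_{n,d}$; primes denote derivatives in $t$. The identities are identities of rational functions in $t$. -}

module Defs where

open import Data.Nat as ℕ using (ℕ; zero; suc; _∸_; _⊓_; _≤?_)
open import Data.Nat.Properties using (_!≢0; m*n≢0)
open import Data.Integer using (+_)
open import Data.Rational using (ℚ; _/_; 0ℚ; _+_; _*_)
import Data.Rational as Q
open import Data.Bool using (if_then_else_)
open import Relation.Nullary.Decidable using (⌊_⌋)
open import Relation.Binary.PropositionalEquality using (_≡_)

-- Univariate polynomials over ℚ, represented by their coefficient
-- function: (p k) is the coefficient of t^k.  All polynomials built
-- below have finite support.
Poly : Set
Poly = ℕ → ℚ

ℕ→ℚ : ℕ → ℚ
ℕ→ℚ n = (+ n) / 1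

C : ℚ → Poly
C c zero    = c
C c (suc k) = 0ℚ

T : Poly
T 1 = Q.1ℚ
T _ = 0ℚ

infixl 6 _⊕_
infixl 7 _⊛_

_⊕_ : Poly → Poly → Poly
(p ⊕ q) k = p k + q k

Σ≤ : ℕ → (ℕ → ℚ) → ℚ
Σ≤ zero    f = f zero
Σ≤ (suc k) f = Σ≤ k f + f (suc k)

_⊛_ : Poly → Poly → Poly
(p ⊛ q) k = Σ≤ k (λ i → p i * q (k ∸ i))

deriv : Poly → Poly
deriv p k = ℕ→ℚ (suc k) * p (suc k)

gcoeff : ℕ → ℕ → ℕ → ℚ
gcoeff n d zero = 0ℚ
gcoeff n d (suc j) =
  if ⌊ suc j ≤? (d ⊓ (n ∸ d)) ⌋
  then _/_ (+ ((n ∸ suc j ∸ 1) ℕ.!))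
         (((d ∸ suc j) ℕ.! ℕ.* (n ∸ d ∸ suc j) ℕ.!) ℕ.* (j ℕ.!))
         {{m*n≢0 _ _ {{m*n≢0 _ _ {{(d ∸ suc j) !≢0}} {{(n ∸ d ∸ suc j) !≢0}}}} {{j !≢0}}}}
  else 0ℚ

g : ℕ → ℕ → Poly
g n d = gcoeff n d

infix 4 _≗ₚ_
_≗ₚ_ : Poly → Poly → Set
p ≗ₚ q = ∀ k → p k ≡ q k

-- For n = d + e and 1 ≤ i ≤ min(d, e), the coefficient of t^i in g_{n,d} is the multinomial
-- coefficient (n-i-1)! / ((i-1)! (d-i)! (e-i)!), and it vanishes for all other i.  Hence the
-- coefficient sequences G₁ of g_{d+e+1,d} and G₀ of g_{d+e,d} satisfy, at every index i,
--
--   i · G₁(i+1) = (d - i) · G₀(i)          and          (e + 1 - i) · G₁(i) = (d + e - i) · G₀(i),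
--
-- the boundary cases holding because a factor or both coefficients vanish.  Comparing
-- coefficients of t^k, the identities
--
--   ((e+1)t + 1) g_{d+e+1,d} = e t g_{d+e,d} + t(t+1) g_{d+e+1,d}′,
--   e ((e+1)t + (e+2)) g_{d+e+1,d} = e ((d+e)t + (d+e+1)) g_{d+e,d} + t(t+1)² g_{d+e+1,d}″
--
-- become linear relations between G₁(k-1), G₁(k), G₁(k+1), G₀(k-1), G₀(k), and each is an
-- explicit polynomial combination of the two relations at k and at k-1.  The theorem is the
-- case e = d - 1 (where g_{2d-1,d} = g_{2d-1,d-1} by the symmetry g_{n,d} = g_{n,n-d}) and the
-- case e = d.

module Submission where

open import Defs

open import Algebra using (CommutativeMonoid)
import Data.Integer as ℤ
import Data.Integer.Properties as ℤₚ
import Data.Integer.Tactic.RingSolver as ℤ-Solver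
open import Data.List using ([]; _∷_)
open import Data.Nat as ℕ using (ℕ; zero; suc; _∸_; _⊓_; _≤_; _!; s≤s)
import Data.Nat.Properties as ℕₚ
import Data.Nat.Tactic.RingSolver as ℕ-Solver
open import Data.Product as Product using (∃-syntax; _,_; _×_)
open import Data.Rational using (ℚ; 0ℚ; 1ℚ; toℚᵘ; _/_)
import Data.Rational.Properties as ℚₚ
open import Data.Rational.Unnormalised as ℚᵘ using (*≡*) renaming (_/_ to _/ᵘ_)
import Data.Rational.Unnormalised.Properties as ℚᵘₚ
open import Data.Sum as Sum using (_⊎_; inj₁; inj₂)
open import Level using (0ℓ)
open import Relation.Binary.PropositionalEquality
open import Relation.Nullary using (¬_)
open import Relation.Nullary.Decidable using (dec⇒maybe; dec-no; dec-yes-recompute)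
import Tactic.RingSolver as Solver
open import Tactic.RingSolver.Core.AlmostCommutativeRing
  using (AlmostCommutativeRing; fromCommutativeRing)

module Arithmetic where
  open import Data.Integer using (+_)
  open import Data.Rational using (_+_; _*_; _-_)

  ℚ-ring : AlmostCommutativeRing 0ℓ 0ℓ
  ℚ-ring = fromCommutativeRing ℚₚ.+-*-commutativeRing (λ x → dec⇒maybe (0ℚ ℚₚ.≟ x))

  eliminate : ∀ {L R x y : ℚ} c → x ≡ y → L ≡ R + c * (x - y) → L ≡ R
  eliminate {R = R} {y = y} c refl L≡ = trans L≡ (Solver.solve (R ∷ c ∷ y ∷ []) ℚ-ring)

  toℚᵘ-/ : ∀ n d .{{_ : ℕ.NonZero d}} → toℚᵘ (+ n / d) ℚᵘ.≃ + n /ᵘ d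
  toℚᵘ-/ n (suc d) = ℚₚ.toℚᵘ-fromℚᵘ (+ n /ᵘ suc d)

  ℕ→ℚ-+ : ∀ m n → ℕ→ℚ (m ℕ.+ n) ≡ ℕ→ℚ m + ℕ→ℚ n
  ℕ→ℚ-+ m n = ℚₚ.toℚᵘ-injective (begin
    toℚᵘ (ℕ→ℚ (m ℕ.+ n))           ≈⟨ toℚᵘ-/ (m ℕ.+ n) 1 ⟩
    + (m ℕ.+ n) /ᵘ 1                 ≈⟨ *≡* (trans (cong (ℤ._* + 1) (ℤₚ.pos-+ m n))
                                                   (*1-distrib (+ m) (+ n))) ⟩
    + m /ᵘ 1 ℚᵘ.+ + n /ᵘ 1           ≈⟨ ℚᵘₚ.+-cong (toℚᵘ-/ m 1) (toℚᵘ-/ n 1) ⟨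
    toℚᵘ (ℕ→ℚ m) ℚᵘ.+ toℚᵘ (ℕ→ℚ n)  ≈⟨ ℚₚ.toℚᵘ-homo-+ (ℕ→ℚ m) (ℕ→ℚ n) ⟨
    toℚᵘ (ℕ→ℚ m + ℕ→ℚ n)            ∎)
    where
    open ℚᵘₚ.≃-Reasoning
    *1-distrib : ∀ x y → (x ℤ.+ y) ℤ.* + 1 ≡ (x ℤ.* + 1 ℤ.+ y ℤ.* + 1) ℤ.* + 1
    *1-distrib = ℤ-Solver.solve-∀

  ℕ→ℚ-≡+ : ∀ {m} n o → m ≡ n ℕ.+ o → ℕ→ℚ m ≡ ℕ→ℚ n + ℕ→ℚ o
  ℕ→ℚ-≡+ n o refl = ℕ→ℚ-+ n o

  ℕ→ℚ-suc : ∀ n → ℕ→ℚ (suc n) ≡ ℕ→ℚ n + 1ℚ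
  ℕ→ℚ-suc n = ℕ→ℚ-≡+ n 1 (ℕₚ.+-comm 1 n)

  ℕ→ℚ-minus : ∀ {m} n o → m ≡ n ℕ.+ o → ℕ→ℚ m - ℕ→ℚ n ≡ ℕ→ℚ o
  ℕ→ℚ-minus n o m≡ =
    trans (cong (_- ℕ→ℚ n) (ℕ→ℚ-≡+ n o m≡)) (x+y-x≡y (ℕ→ℚ n) (ℕ→ℚ o))
    where
    x+y-x≡y : ∀ x y → x + y - x ≡ y
    x+y-x≡y = Solver.solve-∀ ℚ-ring

  ℕ→ℚ-+-minus : ∀ m n o p → m ℕ.+ n ≡ o ℕ.+ p → ℕ→ℚ m + ℕ→ℚ n - ℕ→ℚ o ≡ ℕ→ℚ p
  ℕ→ℚ-+-minus m n o p eq =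
    trans (cong (_- ℕ→ℚ o) (sym (ℕ→ℚ-+ m n))) (ℕ→ℚ-minus o p eq)

  cross-multiply : ∀ u v n₁ n₂ d₁ d₂ .{{_ : ℕ.NonZero d₁}} .{{_ : ℕ.NonZero d₂}} →
                   u ℕ.* n₁ ℕ.* d₂ ≡ v ℕ.* n₂ ℕ.* d₁ →
                   ℕ→ℚ u * (+ n₁ / d₁) ≡ ℕ→ℚ v * (+ n₂ / d₂)
  cross-multiply u v n₁ n₂ d₁@(suc _) d₂@(suc _) eq = ℚₚ.toℚᵘ-injective (begin
    toℚᵘ (ℕ→ℚ u * (+ n₁ / d₁))           ≈⟨ ℚₚ.toℚᵘ-homo-* (ℕ→ℚ u) (+ n₁ / d₁) ⟩
    toℚᵘ (ℕ→ℚ u) ℚᵘ.* toℚᵘ (+ n₁ / d₁)  ≈⟨ ℚᵘₚ.*-cong (toℚᵘ-/ u 1) (toℚᵘ-/ n₁ d₁) ⟩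
    (+ u /ᵘ 1) ℚᵘ.* (+ n₁ /ᵘ d₁)         ≈⟨ *≡* (trans (pos³ u n₁ (1 ℕ.* d₂))
                                                 (trans (cong +_ eq′) (sym (pos³ v n₂ (1 ℕ.* d₁))))) ⟩
    (+ v /ᵘ 1) ℚᵘ.* (+ n₂ /ᵘ d₂)         ≈⟨ ℚᵘₚ.*-cong (toℚᵘ-/ v 1) (toℚᵘ-/ n₂ d₂) ⟨
    toℚᵘ (ℕ→ℚ v) ℚᵘ.* toℚᵘ (+ n₂ / d₂)  ≈⟨ ℚₚ.toℚᵘ-homo-* (ℕ→ℚ v) (+ n₂ / d₂) ⟨
    toℚᵘ (ℕ→ℚ v * (+ n₂ / d₂))           ∎)
    where
    open ℚᵘₚ.≃-Reasoning
    pos³ : ∀ a b c → (+ a ℤ.* + b) ℤ.* + c ≡ + (a ℕ.* b ℕ.* c)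
    pos³ a b c = sym (trans (ℤₚ.pos-* (a ℕ.* b) c) (cong (ℤ._* + c) (ℤₚ.pos-* a b)))
    eq′ : u ℕ.* n₁ ℕ.* (1 ℕ.* d₂) ≡ v ℕ.* n₂ ℕ.* (1 ℕ.* d₁)
    eq′ = subst₂ (λ x y → u ℕ.* n₁ ℕ.* x ≡ v ℕ.* n₂ ℕ.* y)
                 (sym (ℕₚ.*-identityˡ d₂)) (sym (ℕₚ.*-identityˡ d₁)) eq

module Convolution where
  open import Data.Rational using (_+_; _*_; _-_)
  open import Algebra.Properties.CommutativeSemigroup
    (CommutativeMonoid.commutativeSemigroup ℚₚ.+-0-commutativeMonoid) using (interchange)
  open Arithmetic
  open ≡-Reasoning

  shift : Poly → Poly
  shift p zero    = 0ℚ
  shift p (suc k) = p k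

  shift-cong : ∀ {p q} → p ≗ₚ q → shift p ≗ₚ shift q
  shift-cong p≗q zero    = refl
  shift-cong p≗q (suc k) = p≗q k

  shift-suc : ∀ p → p 0 ≡ 0ℚ → shift (λ k → p (suc k)) ≗ₚ p
  shift-suc p p₀≡0 zero    = sym p₀≡0
  shift-suc p p₀≡0 (suc k) = refl

  shift-⊕ : ∀ p q → shift (p ⊕ q) ≗ₚ shift p ⊕ shift q
  shift-⊕ p q zero    = sym (ℚₚ.+-identityʳ 0ℚ)
  shift-⊕ p q (suc k) = refl

  shift-scale : ∀ (f : ℚ → ℚ) p k →
                shift (λ j → f (ℕ→ℚ j) * p j) k ≡ f (ℕ→ℚ k - 1ℚ) * shift p k
  shift-scale f p zero    = sym (ℚₚ.*-zeroʳ (f (ℕ→ℚ 0 - 1ℚ)))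
  shift-scale f p (suc k) = cong (λ x → f x * p k) (sym (ℕ→ℚ-minus 1 k refl))

  shift-deriv : ∀ p k → shift (deriv p) k ≡ ℕ→ℚ k * p k
  shift-deriv p zero    = sym (ℚₚ.*-zeroˡ (p 0))
  shift-deriv p (suc k) = refl

  shift²-deriv : ∀ p k → shift (shift (deriv p)) k ≡ (ℕ→ℚ k - 1ℚ) * shift p k
  shift²-deriv p k = trans (shift-cong (shift-deriv p) k) (shift-scale (λ x → x) p k)

  shift³-deriv : ∀ p k →
                 shift (shift (shift (deriv p))) k ≡ (ℕ→ℚ k - 1ℚ - 1ℚ) * shift (shift p) k
  shift³-deriv p k =
    trans (shift-cong (shift²-deriv p) k) (shift-scale (λ x → x - 1ℚ) (shift p) k)

  Σ≤-peel : ∀ k f → Σ≤ (suc k) f ≡ f 0 + Σ≤ k (λ i → f (suc i))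
  Σ≤-peel zero    f = refl
  Σ≤-peel (suc k) f = trans (cong (_+ f (suc (suc k))) (Σ≤-peel k f)) (ℚₚ.+-assoc (f 0) _ _)

  Σ≤-cong : ∀ k {f h} → (∀ i → f i ≡ h i) → Σ≤ k f ≡ Σ≤ k h
  Σ≤-cong zero    f≗h = f≗h 0
  Σ≤-cong (suc k) f≗h = cong₂ _+_ (Σ≤-cong k f≗h) (f≗h (suc k))

  Σ≤-+ : ∀ k f h → Σ≤ k (λ i → f i + h i) ≡ Σ≤ k f + Σ≤ k h
  Σ≤-+ zero    f h = refl
  Σ≤-+ (suc k) f h = trans (cong (_+ (f (suc k) + h (suc k))) (Σ≤-+ k f h))
                           (interchange (Σ≤ k f) (Σ≤ k h) (f (suc k)) (h (suc k)))

  Σ≤-* : ∀ k c f → Σ≤ k (λ i → c * f i) ≡ c * Σ≤ k f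
  Σ≤-* zero    c f = refl
  Σ≤-* (suc k) c f = trans (cong (_+ c * f (suc k)) (Σ≤-* k c f)) (sym (ℚₚ.*-distribˡ-+ c _ _))

  ⊛-congˡ : ∀ {p q} → p ≗ₚ q → ∀ r → p ⊛ r ≗ₚ q ⊛ r
  ⊛-congˡ p≗q r k = Σ≤-cong k (λ i → cong (_* r (k ∸ i)) (p≗q i))

  ⊛-congʳ : ∀ p {q r} → q ≗ₚ r → p ⊛ q ≗ₚ p ⊛ r
  ⊛-congʳ p q≗r k = Σ≤-cong k (λ i → cong (p i *_) (q≗r (k ∸ i)))

  ⊛-distribʳ-⊕ : ∀ p q r → (p ⊕ q) ⊛ r ≗ₚ p ⊛ r ⊕ q ⊛ r
  ⊛-distribʳ-⊕ p q r k =
    trans (Σ≤-cong k (λ i → ℚₚ.*-distribʳ-+ (r (k ∸ i)) (p i) (q i))) (Σ≤-+ k _ _)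

  C-⊛ : ∀ c p k → (C c ⊛ p) k ≡ c * p k
  C-⊛ c p zero    = refl
  C-⊛ c p (suc k) = begin
    (C c ⊛ p) (suc k)                       ≡⟨ Σ≤-peel k _ ⟩
    c * p (suc k) + Σ≤ k (λ i → 0ℚ * p′ i)  ≡⟨ cong (c * p (suc k) +_) (Σ≤-* k 0ℚ p′) ⟩
    c * p (suc k) + 0ℚ * Σ≤ k p′            ≡⟨ cong (c * p (suc k) +_) (ℚₚ.*-zeroˡ (Σ≤ k p′)) ⟩
    c * p (suc k) + 0ℚ                      ≡⟨ ℚₚ.+-identityʳ (c * p (suc k)) ⟩
    c * p (suc k)                           ∎
    where
    p′ : ℕ → ℚ
    p′ i = p (k ∸ i)

  shift-⊛ : ∀ p q → shift p ⊛ q ≗ₚ shift (p ⊛ q)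
  shift-⊛ p q zero    = ℚₚ.*-zeroˡ (q 0)
  shift-⊛ p q (suc k) = trans (Σ≤-peel k _)
    (trans (cong (_+ (p ⊛ q) k) (ℚₚ.*-zeroˡ (q (suc k)))) (ℚₚ.+-identityˡ ((p ⊛ q) k)))

  T≗shift-1 : T ≗ₚ shift (C 1ℚ)
  T≗shift-1 zero          = refl
  T≗shift-1 (suc zero)    = refl
  T≗shift-1 (suc (suc k)) = refl

  T-⊛ : ∀ p → T ⊛ p ≗ₚ shift p
  T-⊛ p k = begin
    (T ⊛ p) k             ≡⟨ ⊛-congˡ T≗shift-1 p k ⟩
    (shift (C 1ℚ) ⊛ p) k  ≡⟨ shift-⊛ (C 1ℚ) p k ⟩
    shift (C 1ℚ ⊛ p) k    ≡⟨ shift-cong (λ j → trans (C-⊛ 1ℚ p j) (ℚₚ.*-identityˡ (p j))) k ⟩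
    shift p k             ∎

  ⊛-assoc-C : ∀ c p q k → (C c ⊛ p ⊛ q) k ≡ c * (p ⊛ q) k
  ⊛-assoc-C c p q k = trans (Σ≤-cong k reassociate) (Σ≤-* k c _)
    where
    reassociate : ∀ i → (C c ⊛ p) i * q (k ∸ i) ≡ c * (p i * q (k ∸ i))
    reassociate i = trans (cong (_* q (k ∸ i)) (C-⊛ c p i)) (ℚₚ.*-assoc c (p i) (q (k ∸ i)))

  ⊛-assoc-T : ∀ p q → T ⊛ p ⊛ q ≗ₚ shift (p ⊛ q)
  ⊛-assoc-T p q k = trans (⊛-congˡ (T-⊛ p) q k) (shift-⊛ p q k)

  CT-⊛ : ∀ c p k → (C c ⊛ T ⊛ p) k ≡ c * shift p k
  CT-⊛ c p k = trans (⊛-assoc-C c T p k) (cong (c *_) (T-⊛ p k))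

  CT⊕C-⊛ : ∀ a b p k → ((C a ⊛ T ⊕ C b) ⊛ p) k ≡ a * shift p k + b * p k
  CT⊕C-⊛ a b p k =
    trans (⊛-distribʳ-⊕ (C a ⊛ T) (C b) p k) (cong₂ _+_ (CT-⊛ a p k) (C-⊛ b p k))

  merge-T : ∀ c a b p → C c ⊛ (C a ⊛ T ⊕ T ⊕ C b) ⊛ p ≗ₚ C c ⊛ (C (a + 1ℚ) ⊛ T ⊕ C b) ⊛ p
  merge-T c a b p = ⊛-congˡ (⊛-congʳ (C c) (λ k → cong (_+ C b k) (aT+T≡[a+1]T k))) p
    where
    aT+T≡[a+1]T : ∀ k → (C a ⊛ T) k + T k ≡ (C (a + 1ℚ) ⊛ T) k
    aT+T≡[a+1]T k = begin
      (C a ⊛ T) k + T k   ≡⟨ cong₂ _+_ (C-⊛ a T k) (sym (ℚₚ.*-identityˡ (T k))) ⟩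
      a * T k + 1ℚ * T k  ≡⟨ ℚₚ.*-distribʳ-+ (T k) a 1ℚ ⟨
      (a + 1ℚ) * T k      ≡⟨ C-⊛ (a + 1ℚ) T k ⟨
      (C (a + 1ℚ) ⊛ T) k  ∎

  T⊕1-⊛ : ∀ p → (T ⊕ C 1ℚ) ⊛ p ≗ₚ shift p ⊕ p
  T⊕1-⊛ p k = trans (⊛-distribʳ-⊕ T (C 1ℚ) p k)
                    (cong₂ _+_ (T-⊛ p k) (trans (C-⊛ 1ℚ p k) (ℚₚ.*-identityˡ (p k))))

  T⊕1-⊛-assoc : ∀ p q → (T ⊕ C 1ℚ) ⊛ p ⊛ q ≗ₚ shift (p ⊛ q) ⊕ p ⊛ q
  T⊕1-⊛-assoc p q k = begin
    ((T ⊕ C 1ℚ) ⊛ p ⊛ q) k              ≡⟨ ⊛-congˡ (⊛-distribʳ-⊕ T (C 1ℚ) p) q k ⟩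
    ((T ⊛ p ⊕ C 1ℚ ⊛ p) ⊛ q) k          ≡⟨ ⊛-distribʳ-⊕ (T ⊛ p) (C 1ℚ ⊛ p) q k ⟩
    (T ⊛ p ⊛ q) k + (C 1ℚ ⊛ p ⊛ q) k    ≡⟨ cong₂ _+_ (⊛-assoc-T p q k) (⊛-assoc-C 1ℚ p q k) ⟩
    shift (p ⊛ q) k + 1ℚ * (p ⊛ q) k     ≡⟨ cong (shift (p ⊛ q) k +_) (ℚₚ.*-identityˡ _) ⟩
    shift (p ⊛ q) k + (p ⊛ q) k          ∎

  t[t+1]-⊛ : ∀ p k → (T ⊛ (T ⊕ C 1ℚ) ⊛ p) k ≡ shift (shift p) k + shift p k
  t[t+1]-⊛ p k = begin
    (T ⊛ (T ⊕ C 1ℚ) ⊛ p) k         ≡⟨ ⊛-assoc-T (T ⊕ C 1ℚ) p k ⟩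
    shift ((T ⊕ C 1ℚ) ⊛ p) k       ≡⟨ shift-cong (T⊕1-⊛ p) k ⟩
    shift (shift p ⊕ p) k          ≡⟨ shift-⊕ (shift p) p k ⟩
    shift (shift p) k + shift p k  ∎

  t[t+1]²-⊛ : ∀ p k → (T ⊛ (T ⊕ C 1ℚ) ⊛ (T ⊕ C 1ℚ) ⊛ p) k
                    ≡ (shift (shift (shift p)) k + shift (shift p) k) + (shift (shift p) k + shift p k)
  t[t+1]²-⊛ p k = begin
    (T ⊛ P ⊛ P ⊛ p) k                          ≡⟨ ⊛-congˡ (⊛-assoc-T P P) p k ⟩
    (shift (P ⊛ P) ⊛ p) k                      ≡⟨ shift-⊛ (P ⊛ P) p k ⟩
    shift (P ⊛ P ⊛ p) k                        ≡⟨ shift-cong (T⊕1-⊛-assoc P p) k ⟩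
    shift (shift (P ⊛ p) ⊕ P ⊛ p) k            ≡⟨ shift-⊕ (shift (P ⊛ p)) (P ⊛ p) k ⟩
    shift (shift (P ⊛ p)) k + shift (P ⊛ p) k  ≡⟨ cong₂ _+_ (shift-cong (shift-cong (T⊕1-⊛ p)) k)
                                                            (shift-cong (T⊕1-⊛ p) k) ⟩
    shift (shift (shift p ⊕ p)) k + shift (shift p ⊕ p) k
      ≡⟨ cong₂ _+_ (trans (shift-cong (shift-⊕ (shift p) p) k) (shift-⊕ _ _ k))
                   (shift-⊕ (shift p) p k) ⟩
    (shift (shift (shift p)) k + shift (shift p) k) + (shift (shift p) k + shift p k) ∎
    where
    P : Poly
    P = T ⊕ C 1ℚ

  t[t+1]-⊛-deriv : ∀ p k →
    (T ⊛ (T ⊕ C 1ℚ) ⊛ deriv p) k ≡ (ℕ→ℚ k - 1ℚ) * shift p k + ℕ→ℚ k * p k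
  t[t+1]-⊛-deriv p k =
    trans (t[t+1]-⊛ (deriv p) k) (cong₂ _+_ (shift²-deriv p k) (shift-deriv p k))

  t[t+1]²-⊛-deriv² : ∀ p k →
    (T ⊛ (T ⊕ C 1ℚ) ⊛ (T ⊕ C 1ℚ) ⊛ deriv (deriv p)) k
      ≡ ((ℕ→ℚ k - 1ℚ - 1ℚ) * ((ℕ→ℚ k - 1ℚ) * shift p k) + (ℕ→ℚ k - 1ℚ) * (ℕ→ℚ k * p k))
        + ((ℕ→ℚ k - 1ℚ) * (ℕ→ℚ k * p k) + ℕ→ℚ k * (ℕ→ℚ (suc k) * p (suc k)))
  t[t+1]²-⊛-deriv² p k = trans (t[t+1]²-⊛ (deriv (deriv p)) k)
    (cong₂ _+_ (cong₂ _+_ shift³ shift²) (cong₂ _+_ shift² (shift-deriv (deriv p) k)))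
    where
    K : ℚ
    K = ℕ→ℚ k
    shift³ : shift (shift (shift (deriv (deriv p)))) k ≡ (K - 1ℚ - 1ℚ) * ((K - 1ℚ) * shift p k)
    shift³ = trans (shift³-deriv (deriv p) k) (cong ((K - 1ℚ - 1ℚ) *_) (shift²-deriv p k))
    shift² : shift (shift (deriv (deriv p))) k ≡ (K - 1ℚ) * (K * p k)
    shift² = trans (shift²-deriv (deriv p) k) (cong ((K - 1ℚ) *_) (shift-deriv p k))

module Coefficients where
  open import Data.Integer using (+_)
  open import Data.Rational using (_+_; _*_; _-_)
  open Arithmetic
  open ≡-Reasoning

  !*!*!≢0 : ∀ a b c → ℕ.NonZero ((a ! ℕ.* b !) ℕ.* c !)
  !*!*!≢0 a b c = ℕₚ.m*n≢0 _ _ {{a ℕₚ.!* b !≢0}} {{c ℕₚ.!≢0}}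

  multinomial : ℕ → ℕ → ℕ → ℚ
  multinomial j q r = (+ ((j ℕ.+ q ℕ.+ r) !) / ((q ! ℕ.* r !) ℕ.* j !)) {{ !*!*!≢0 q r j }}

  multinomial-sym : ∀ j q r → multinomial j q r ≡ multinomial j r q
  multinomial-sym j q r = ℚₚ./-cong {{ !*!*!≢0 q r j }} {{ !*!*!≢0 r q j }}
    (cong (λ n → + (n !)) (j+q+r≡j+r+q j q r)) (cong (ℕ._* j !) (ℕₚ.*-comm (q !) (r !)))
    where
    j+q+r≡j+r+q : ∀ j q r → j ℕ.+ q ℕ.+ r ≡ j ℕ.+ r ℕ.+ q
    j+q+r≡j+r+q = ℕ-Solver.solve-∀

  multinomial-absorb : ∀ j q r →
    ℕ→ℚ (suc r) * multinomial j q (suc r) ≡ ℕ→ℚ (suc (j ℕ.+ q ℕ.+ r)) * multinomial j q r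
  multinomial-absorb j q r =
    cross-multiply (suc r) (suc s) ((j ℕ.+ q ℕ.+ suc r) !) (s !)
                   ((q ! ℕ.* suc r !) ℕ.* j !) ((q ! ℕ.* r !) ℕ.* j !)
                   {{ !*!*!≢0 q (suc r) j }} {{ !*!*!≢0 q r j }} (begin
      suc r ℕ.* (j ℕ.+ q ℕ.+ suc r) ! ℕ.* ((q ! ℕ.* r !) ℕ.* j !)
        ≡⟨ cong (λ n → suc r ℕ.* n ! ℕ.* ((q ! ℕ.* r !) ℕ.* j !)) (ℕₚ.+-suc (j ℕ.+ q) r) ⟩
      suc r ℕ.* (suc s ℕ.* s !) ℕ.* ((q ! ℕ.* r !) ℕ.* j !)
        ≡⟨ regroup (suc r) (suc s) (s !) (q !) (r !) (j !) ⟩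
      suc s ℕ.* s ! ℕ.* ((q ! ℕ.* (suc r ℕ.* r !)) ℕ.* j !) ∎)
    where
    s : ℕ
    s = j ℕ.+ q ℕ.+ r
    regroup : ∀ a b N Q R J → a ℕ.* (b ℕ.* N) ℕ.* ((Q ℕ.* R) ℕ.* J) ≡ b ℕ.* N ℕ.* ((Q ℕ.* (a ℕ.* R)) ℕ.* J)
    regroup = ℕ-Solver.solve-∀

  multinomial-exchange : ∀ j q r →
    ℕ→ℚ (suc j) * multinomial (suc j) q r ≡ ℕ→ℚ (suc q) * multinomial j (suc q) r
  multinomial-exchange j q r =
    cross-multiply (suc j) (suc q) (suc s !) ((j ℕ.+ suc q ℕ.+ r) !)
                   ((q ! ℕ.* r !) ℕ.* suc j !) ((suc q ! ℕ.* r !) ℕ.* j !)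
                   {{ !*!*!≢0 q r (suc j) }} {{ !*!*!≢0 (suc q) r j }} (begin
      suc j ℕ.* (suc s ℕ.* s !) ℕ.* (((suc q ℕ.* q !) ℕ.* r !) ℕ.* j !)
        ≡⟨ regroup (suc j) (suc q) (suc s) (s !) (q !) (r !) (j !) ⟩
      suc q ℕ.* (suc s ℕ.* s !) ℕ.* ((q ! ℕ.* r !) ℕ.* (suc j ℕ.* j !))
        ≡⟨ cong (λ n → suc q ℕ.* (n ℕ.+ r) ! ℕ.* ((q ! ℕ.* r !) ℕ.* (suc j ℕ.* j !))) (ℕₚ.+-suc j q) ⟨
      suc q ℕ.* (j ℕ.+ suc q ℕ.+ r) ! ℕ.* ((q ! ℕ.* r !) ℕ.* (suc j ℕ.* j !)) ∎)
    where
    s : ℕ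
    s = j ℕ.+ q ℕ.+ r
    regroup : ∀ a b c N Q R J →
      a ℕ.* (c ℕ.* N) ℕ.* (((b ℕ.* Q) ℕ.* R) ℕ.* J) ≡ b ℕ.* (c ℕ.* N) ℕ.* ((Q ℕ.* R) ℕ.* (a ℕ.* J))
    regroup = ℕ-Solver.solve-∀

  g-vanish : ∀ n d j → ¬ (suc j ≤ d ⊓ (n ∸ d)) → g n d (suc j) ≡ 0ℚ
  g-vanish n d j outside rewrite dec-no (suc j ℕ.≤? d ⊓ (n ∸ d)) outside = refl

  g-vanishˡ : ∀ n {d j} → d ≤ j → g n d (suc j) ≡ 0ℚ
  g-vanishˡ n {d} d≤j = g-vanish n d _ (ℕₚ.≤⇒≯ (ℕₚ.≤-trans (ℕₚ.m⊓n≤m d (n ∸ d)) d≤j))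

  g-vanishʳ : ∀ d {e j} → e ≤ j → g (d ℕ.+ e) d (suc j) ≡ 0ℚ
  g-vanishʳ d {e} e≤j = g-vanish (d ℕ.+ e) d _
    (ℕₚ.≤⇒≯ (ℕₚ.≤-trans (ℕₚ.m⊓n≤n d _) (subst (_≤ _) (sym (ℕₚ.m+n∸m≡n d e)) e≤j)))

  g-inside : ∀ n d j → suc j ≤ d ⊓ (n ∸ d) →
             g n d (suc j) ≡ (+ ((n ∸ suc j ∸ 1) !) / (((d ∸ suc j) ! ℕ.* (n ∸ d ∸ suc j) !) ℕ.* j !))
                               {{ !*!*!≢0 (d ∸ suc j) (n ∸ d ∸ suc j) j }}
  g-inside n d j inside rewrite dec-yes-recompute (suc j ℕ.≤? d ⊓ (n ∸ d)) inside = refl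

  suc+suc≡ : ∀ j q r → suc (j ℕ.+ q) ℕ.+ suc (j ℕ.+ r) ≡ suc j ℕ.+ suc (j ℕ.+ q ℕ.+ r)
  suc+suc≡ = ℕ-Solver.solve-∀

  g-closed : ∀ {n d} j q r → d ≡ suc (j ℕ.+ q) → n ≡ d ℕ.+ suc (j ℕ.+ r) →
             g n d (suc j) ≡ multinomial j q r
  g-closed {n} {d} j q r refl refl =
    trans (g-inside n d j inside)
          (ℚₚ./-cong {{ !*!*!≢0 (d ∸ suc j) (n ∸ d ∸ suc j) j }} {{ !*!*!≢0 q r j }}
                     (cong (λ m → + (m !)) top) (cong₂ (λ x y → (x ! ℕ.* y !) ℕ.* j !) left right))
    where
    n∸d : n ∸ d ≡ suc (j ℕ.+ r)
    n∸d = ℕₚ.m+n∸m≡n d _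
    inside : suc j ≤ d ⊓ (n ∸ d)
    inside = ℕₚ.⊓-glb (s≤s (ℕₚ.m≤m+n j q)) (subst (suc j ≤_) (sym n∸d) (s≤s (ℕₚ.m≤m+n j r)))
    top : n ∸ suc j ∸ 1 ≡ j ℕ.+ q ℕ.+ r
    top = cong (_∸ 1) (trans (cong (_∸ suc j) (suc+suc≡ j q r)) (ℕₚ.m+n∸m≡n (suc j) _))
    left : d ∸ suc j ≡ q
    left = ℕₚ.m+n∸m≡n (suc j) q
    right : n ∸ d ∸ suc j ≡ r
    right = trans (cong (_∸ suc j) n∸d) (ℕₚ.m+n∸m≡n (suc j) r)

  ≤⊎> : ∀ m j → m ≤ j ⊎ ∃[ q ] m ≡ suc (j ℕ.+ q)
  ≤⊎> m j = Sum.map₂ (λ j<m → Product.map₂ sym (ℕₚ.m≤n⇒∃[o]m+o≡n j<m)) (ℕₚ.≤-<-connex m j)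

  *-vanishʳ : ∀ u {x} → x ≡ 0ℚ → u * x ≡ 0ℚ
  *-vanishʳ u refl = ℚₚ.*-zeroʳ u

  *-vanishˡ : ∀ {u} x → u ≡ 0ℚ → u * x ≡ 0ℚ
  *-vanishˡ x refl = ℚₚ.*-zeroˡ x

  g-sym : ∀ d e → g (d ℕ.+ e) d ≗ₚ g (e ℕ.+ d) e
  g-sym d e zero    = refl
  g-sym d e (suc j) = by-cases (≤⊎> d j) (≤⊎> e j)
    where
    by-cases : d ≤ j ⊎ ∃[ q ] d ≡ suc (j ℕ.+ q) → e ≤ j ⊎ ∃[ r ] e ≡ suc (j ℕ.+ r) →
               g (d ℕ.+ e) d (suc j) ≡ g (e ℕ.+ d) e (suc j)
    by-cases (inj₁ d≤j)       _                = trans (g-vanishˡ (d ℕ.+ e) d≤j) (sym (g-vanishʳ e d≤j))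
    by-cases (inj₂ _)         (inj₁ e≤j)       = trans (g-vanishʳ d e≤j) (sym (g-vanishˡ (e ℕ.+ d) e≤j))
    by-cases (inj₂ (q , d≡)) (inj₂ (r , e≡)) = begin
      g (d ℕ.+ e) d (suc j)  ≡⟨ g-closed j q r d≡ (cong (d ℕ.+_) e≡) ⟩
      multinomial j q r      ≡⟨ multinomial-sym j q r ⟩
      multinomial j r q      ≡⟨ g-closed j r q e≡ (cong (e ℕ.+_) d≡) ⟨
      g (e ℕ.+ d) e (suc j)  ∎

  g-cross : ∀ d e i → ℕ→ℚ i * g (d ℕ.+ suc e) d (suc i) ≡ (ℕ→ℚ d - ℕ→ℚ i) * g (d ℕ.+ e) d i
  g-cross d e zero    = trans (ℚₚ.*-zeroˡ (g (d ℕ.+ suc e) d 1)) (sym (ℚₚ.*-zeroʳ (ℕ→ℚ d - 0ℚ)))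
  g-cross d e (suc j) = by-cases (≤⊎> d j) (≤⊎> e j)
    where
    I : ℚ
    I = ℕ→ℚ (suc j)
    by-cases : d ≤ j ⊎ ∃[ q ] d ≡ suc (j ℕ.+ q) → e ≤ j ⊎ ∃[ r ] e ≡ suc (j ℕ.+ r) →
               I * g (d ℕ.+ suc e) d (suc (suc j)) ≡ (ℕ→ℚ d - I) * g (d ℕ.+ e) d (suc j)
    by-cases (inj₁ d≤j) _ =
      trans (*-vanishʳ I (g-vanishˡ (d ℕ.+ suc e) (ℕₚ.m≤n⇒m≤1+n d≤j)))
            (sym (*-vanishʳ (ℕ→ℚ d - I) (g-vanishˡ (d ℕ.+ e) d≤j)))
    by-cases (inj₂ (zero , d≡)) _ =
      trans (*-vanishʳ I (g-vanishˡ (d ℕ.+ suc e) (ℕₚ.≤-reflexive (trans d≡ (cong suc (ℕₚ.+-identityʳ j))))))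
            (sym (*-vanishˡ (g (d ℕ.+ e) d (suc j)) (ℕ→ℚ-minus (suc j) 0 d≡)))
    by-cases (inj₂ (suc q , _)) (inj₁ e≤j) =
      trans (*-vanishʳ I (g-vanishʳ d (s≤s e≤j))) (sym (*-vanishʳ (ℕ→ℚ d - I) (g-vanishʳ d e≤j)))
    by-cases (inj₂ (suc q , d≡)) (inj₂ (r , e≡)) = begin
      I * g (d ℕ.+ suc e) d (suc (suc j))
        ≡⟨ cong (I *_) (g-closed (suc j) q r (trans d≡ (cong suc (ℕₚ.+-suc j q)))
                                             (cong (λ x → d ℕ.+ suc x) e≡)) ⟩
      I * multinomial (suc j) q r
        ≡⟨ multinomial-exchange j q r ⟩
      ℕ→ℚ (suc q) * multinomial j (suc q) r
        ≡⟨ cong₂ _*_ (ℕ→ℚ-minus (suc j) (suc q) d≡) (g-closed j (suc q) r d≡ (cong (d ℕ.+_) e≡)) ⟨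
      (ℕ→ℚ d - I) * g (d ℕ.+ e) d (suc j) ∎

  g-step : ∀ d e i →
    (ℕ→ℚ e + 1ℚ - ℕ→ℚ i) * g (d ℕ.+ suc e) d i ≡ (ℕ→ℚ d + ℕ→ℚ e - ℕ→ℚ i) * g (d ℕ.+ e) d i
  g-step d e zero    = trans (ℚₚ.*-zeroʳ (ℕ→ℚ e + 1ℚ - 0ℚ)) (sym (ℚₚ.*-zeroʳ (ℕ→ℚ d + ℕ→ℚ e - 0ℚ)))
  g-step d e (suc j) = by-cases (≤⊎> d j) (≤⊎> (suc e) j)
    where
    I : ℚ
    I = ℕ→ℚ (suc j)
    by-cases : d ≤ j ⊎ ∃[ q ] d ≡ suc (j ℕ.+ q) → suc e ≤ j ⊎ ∃[ r ] suc e ≡ suc (j ℕ.+ r) →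
               (ℕ→ℚ e + 1ℚ - I) * g (d ℕ.+ suc e) d (suc j) ≡ (ℕ→ℚ d + ℕ→ℚ e - I) * g (d ℕ.+ e) d (suc j)
    by-cases (inj₁ d≤j) _ =
      trans (*-vanishʳ (ℕ→ℚ e + 1ℚ - I) (g-vanishˡ (d ℕ.+ suc e) d≤j))
            (sym (*-vanishʳ (ℕ→ℚ d + ℕ→ℚ e - I) (g-vanishˡ (d ℕ.+ e) d≤j)))
    by-cases (inj₂ _) (inj₁ e<j) =
      trans (*-vanishʳ (ℕ→ℚ e + 1ℚ - I) (g-vanishʳ d e<j))
            (sym (*-vanishʳ (ℕ→ℚ d + ℕ→ℚ e - I) (g-vanishʳ d (ℕₚ.<⇒≤ e<j))))
    by-cases (inj₂ _) (inj₂ (zero , 1+e≡)) =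
      trans (*-vanishˡ (g (d ℕ.+ suc e) d (suc j)) (ℕ→ℚ-+-minus e 1 (suc j) 0 (trans (ℕₚ.+-comm e 1) 1+e≡)))
            (sym (*-vanishʳ (ℕ→ℚ d + ℕ→ℚ e - I) (g-vanishʳ d e≤j)))
      where
      e≤j : e ≤ j
      e≤j = ℕₚ.≤-reflexive (trans (ℕₚ.suc-injective 1+e≡) (ℕₚ.+-identityʳ j))
    by-cases (inj₂ (q , d≡)) (inj₂ (suc r , 1+e≡)) = begin
      (ℕ→ℚ e + 1ℚ - I) * g (d ℕ.+ suc e) d (suc j)
        ≡⟨ cong₂ _*_ (ℕ→ℚ-+-minus e 1 (suc j) (suc r) (trans (cong (ℕ._+ 1) e≡) (suc+1≡ j r)))
                     (g-closed j q (suc r) d≡ (cong (λ x → d ℕ.+ suc x) (ℕₚ.suc-injective 1+e≡))) ⟩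
      ℕ→ℚ (suc r) * multinomial j q (suc r)
        ≡⟨ multinomial-absorb j q r ⟩
      ℕ→ℚ (suc (j ℕ.+ q ℕ.+ r)) * multinomial j q r
        ≡⟨ cong₂ _*_ (ℕ→ℚ-+-minus d e (suc j) _ (trans (cong₂ ℕ._+_ d≡ e≡) (suc+suc≡ j q r)))
                     (g-closed j q r d≡ (cong (d ℕ.+_) e≡)) ⟨
      (ℕ→ℚ d + ℕ→ℚ e - I) * g (d ℕ.+ e) d (suc j) ∎
      where
      e≡ : e ≡ suc (j ℕ.+ r)
      e≡ = trans (ℕₚ.suc-injective 1+e≡) (ℕₚ.+-suc j r)
      suc+1≡ : ∀ j r → suc (j ℕ.+ r) ℕ.+ 1 ≡ suc j ℕ.+ suc r
      suc+1≡ = ℕ-Solver.solve-∀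

module Recurrences where
  open import Data.Rational using (_+_; _*_; _-_; -_)
  open Arithmetic
  open Convolution
  open Coefficients
  open ≡-Reasoning

  record Contiguous (G₁ G₀ : Poly) (D E : ℚ) : Set where
    field
      zero-term : G₁ 0 ≡ 0ℚ
      cross     : ∀ i → ℕ→ℚ i * G₁ (suc i) ≡ (D - ℕ→ℚ i) * G₀ i
      step      : ∀ i → (E + 1ℚ - ℕ→ℚ i) * G₁ i ≡ (D + E - ℕ→ℚ i) * G₀ i

    shifted-cross : ∀ k → (ℕ→ℚ k - 1ℚ) * G₁ k ≡ (D - (ℕ→ℚ k - 1ℚ)) * shift G₀ k
    shifted-cross k = begin
      (ℕ→ℚ k - 1ℚ) * G₁ k                        ≡⟨ cong ((ℕ→ℚ k - 1ℚ) *_) (shift-suc G₁ zero-term k) ⟨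
      (ℕ→ℚ k - 1ℚ) * shift (λ i → G₁ (suc i)) k  ≡⟨ shift-scale (λ x → x) (λ i → G₁ (suc i)) k ⟨
      shift (λ i → ℕ→ℚ i * G₁ (suc i)) k         ≡⟨ shift-cong cross k ⟩
      shift (λ i → (D - ℕ→ℚ i) * G₀ i) k         ≡⟨ shift-scale (λ x → D - x) G₀ k ⟩
      (D - (ℕ→ℚ k - 1ℚ)) * shift G₀ k            ∎

    shifted-step : ∀ k → (E + 1ℚ - (ℕ→ℚ k - 1ℚ)) * shift G₁ k ≡ (D + E - (ℕ→ℚ k - 1ℚ)) * shift G₀ k
    shifted-step k = begin
      (E + 1ℚ - (ℕ→ℚ k - 1ℚ)) * shift G₁ k     ≡⟨ shift-scale (λ x → E + 1ℚ - x) G₁ k ⟨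
      shift (λ i → (E + 1ℚ - ℕ→ℚ i) * G₁ i) k  ≡⟨ shift-cong step k ⟩
      shift (λ i → (D + E - ℕ→ℚ i) * G₀ i) k   ≡⟨ shift-scale (λ x → D + E - x) G₀ k ⟩
      (D + E - (ℕ→ℚ k - 1ℚ)) * shift G₀ k      ∎

  g-contiguous : ∀ d e → Contiguous (g (d ℕ.+ suc e) d) (g (d ℕ.+ e) d) (ℕ→ℚ d) (ℕ→ℚ e)
  g-contiguous d e = record { zero-term = refl ; cross = g-cross d e ; step = g-step d e }

  contiguous-cong : ∀ {G₁ G₁′ G₀ G₀′ D E} → G₁ ≗ₚ G₁′ → G₀ ≗ₚ G₀′ →
                    Contiguous G₁ G₀ D E → Contiguous G₁′ G₀′ D E
  contiguous-cong {D = D} {E} G₁≗ G₀≗ c = record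
    { zero-term = trans (sym (G₁≗ 0)) zero-term
    ; cross     = λ i → subst₂ (λ x y → ℕ→ℚ i * x ≡ (D - ℕ→ℚ i) * y) (G₁≗ (suc i)) (G₀≗ i) (cross i)
    ; step      = λ i → subst₂ (λ x y → (E + 1ℚ - ℕ→ℚ i) * x ≡ (D + E - ℕ→ℚ i) * y)
                               (G₁≗ i) (G₀≗ i) (step i)
    }
    where open Contiguous c

  even-contiguous : ∀ d → Contiguous (g (2 ℕ.* suc d) (suc d)) (g (2 ℕ.* suc d ∸ 1) d) (ℕ→ℚ (suc d)) (ℕ→ℚ d)
  even-contiguous d = contiguous-cong
    (λ k → cong (λ n → g n (suc d) k) (cong (suc d ℕ.+_) (sym (ℕₚ.+-identityʳ (suc d)))))
    (λ k → trans (g-sym (suc d) d k)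
                 (cong (λ n → g n d k) (cong (λ m → d ℕ.+ suc m) (sym (ℕₚ.+-identityʳ d)))))
    (g-contiguous (suc d) d)

  odd-contiguous : ∀ d → Contiguous (g (2 ℕ.* d ℕ.+ 1) d) (g (2 ℕ.* d) d) (ℕ→ℚ d) (ℕ→ℚ d)
  odd-contiguous d = contiguous-cong
    (λ k → cong (λ n → g n d k) (d+suc-d≡2d+1 d))
    (λ k → cong (λ n → g n d k) (d+d≡2d d))
    (g-contiguous d d)
    where
    d+suc-d≡2d+1 : ∀ d → d ℕ.+ suc d ≡ 2 ℕ.* d ℕ.+ 1
    d+suc-d≡2d+1 = ℕ-Solver.solve-∀
    d+d≡2d : ∀ d → d ℕ.+ d ≡ 2 ℕ.* d
    d+d≡2d = ℕ-Solver.solve-∀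

  -- p₋, p, p₊ and q₋, q stand for the coefficients of t^(k-1), t^k, t^(k+1) in G₁ and G₀.
  first-order-coefficient : ∀ D E K p₋ p q₋ →
    (K - 1ℚ) * p ≡ (D - (K - 1ℚ)) * q₋ →
    (E + 1ℚ - (K - 1ℚ)) * p₋ ≡ (D + E - (K - 1ℚ)) * q₋ →
    (E + 1ℚ) * p₋ + 1ℚ * p ≡ E * q₋ + ((K - 1ℚ) * p₋ + K * p)
  first-order-coefficient D E K p₋ p q₋ shifted-cross shifted-step =
    eliminate (- 1ℚ) shifted-cross (eliminate 1ℚ shifted-step
      (Solver.solve (D ∷ E ∷ K ∷ p₋ ∷ p ∷ q₋ ∷ []) ℚ-ring))

  second-order-coefficient : ∀ D E K {K₁} p₋ p p₊ q₋ q → K₁ ≡ 1ℚ + K →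
    K * p₊ ≡ (D - K) * q →
    (K - 1ℚ) * p ≡ (D - (K - 1ℚ)) * q₋ →
    (E + 1ℚ - K) * p ≡ (D + E - K) * q →
    (E + 1ℚ - (K - 1ℚ)) * p₋ ≡ (D + E - (K - 1ℚ)) * q₋ →
    E * ((E + 1ℚ) * p₋ + (E + ℕ→ℚ 2) * p)
      ≡ E * ((D + E) * q₋ + (D + E + 1ℚ) * q)
        + (((K - 1ℚ - 1ℚ) * ((K - 1ℚ) * p₋) + (K - 1ℚ) * (K * p)) + ((K - 1ℚ) * (K * p) + K * (K₁ * p₊)))
  second-order-coefficient D E K p₋ p p₊ q₋ q refl cross shifted-cross step shifted-step =
    eliminate (- (K + 1ℚ)) cross (eliminate (1ℚ - K) shifted-cross
      (eliminate (E + K + 1ℚ) step (eliminate (E + K - 1ℚ) shifted-step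
        (Solver.solve (D ∷ E ∷ K ∷ p₋ ∷ p ∷ p₊ ∷ q₋ ∷ q ∷ []) ℚ-ring))))

  first-order-identity : ∀ {G₁ G₀ D E E₁} → Contiguous G₁ G₀ D E → E₁ ≡ E + 1ℚ →
    (C E₁ ⊛ T ⊕ C 1ℚ) ⊛ G₁ ≗ₚ C E ⊛ T ⊛ G₀ ⊕ T ⊛ (T ⊕ C 1ℚ) ⊛ deriv G₁
  first-order-identity {G₁} {G₀} {D} {E} c refl k = begin
    ((C (E + 1ℚ) ⊛ T ⊕ C 1ℚ) ⊛ G₁) k
      ≡⟨ CT⊕C-⊛ (E + 1ℚ) 1ℚ G₁ k ⟩
    (E + 1ℚ) * shift G₁ k + 1ℚ * G₁ k
      ≡⟨ first-order-coefficient D E (ℕ→ℚ k) (shift G₁ k) (G₁ k) (shift G₀ k)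
                                 (shifted-cross k) (shifted-step k) ⟩
    E * shift G₀ k + ((ℕ→ℚ k - 1ℚ) * shift G₁ k + ℕ→ℚ k * G₁ k)
      ≡⟨ cong₂ _+_ (CT-⊛ E G₀ k) (t[t+1]-⊛-deriv G₁ k) ⟨
    (C E ⊛ T ⊛ G₀ ⊕ T ⊛ (T ⊕ C 1ℚ) ⊛ deriv G₁) k ∎
    where open Contiguous c

  second-order-identity : ∀ {G₁ G₀ D E E₁ E₂ U V} → Contiguous G₁ G₀ D E →
    E₁ ≡ E + 1ℚ → E₂ ≡ E + ℕ→ℚ 2 → U ≡ D + E → V ≡ U + 1ℚ →
    C E ⊛ (C E₁ ⊛ T ⊕ C E₂) ⊛ G₁
      ≗ₚ C E ⊛ (C U ⊛ T ⊕ C V) ⊛ G₀ ⊕ T ⊛ (T ⊕ C 1ℚ) ⊛ (T ⊕ C 1ℚ) ⊛ deriv (deriv G₁)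
  second-order-identity {G₁} {G₀} {D} {E} c refl refl refl refl k = begin
    (C E ⊛ (C (E + 1ℚ) ⊛ T ⊕ C (E + ℕ→ℚ 2)) ⊛ G₁) k
      ≡⟨ linear G₁ (E + 1ℚ) (E + ℕ→ℚ 2) ⟩
    E * ((E + 1ℚ) * shift G₁ k + (E + ℕ→ℚ 2) * G₁ k)
      ≡⟨ second-order-coefficient D E K (shift G₁ k) (G₁ k) (G₁ (suc k)) (shift G₀ k) (G₀ k)
                                  (ℕ→ℚ-+ 1 k) (cross k) (shifted-cross k) (step k) (shifted-step k) ⟩
    E * ((D + E) * shift G₀ k + (D + E + 1ℚ) * G₀ k)
      + (((K - 1ℚ - 1ℚ) * ((K - 1ℚ) * shift G₁ k) + (K - 1ℚ) * (K * G₁ k))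
        + ((K - 1ℚ) * (K * G₁ k) + K * (ℕ→ℚ (suc k) * G₁ (suc k))))
      ≡⟨ cong₂ _+_ (linear G₀ (D + E) (D + E + 1ℚ)) (t[t+1]²-⊛-deriv² G₁ k) ⟨
    (C E ⊛ (C (D + E) ⊛ T ⊕ C (D + E + 1ℚ)) ⊛ G₀
      ⊕ T ⊛ (T ⊕ C 1ℚ) ⊛ (T ⊕ C 1ℚ) ⊛ deriv (deriv G₁)) k ∎
    where
    open Contiguous c
    K : ℚ
    K = ℕ→ℚ k
    linear : ∀ G a b → (C E ⊛ (C a ⊛ T ⊕ C b) ⊛ G) k ≡ E * (a * shift G k + b * G k)
    linear G a b = trans (⊛-assoc-C E (C a ⊛ T ⊕ C b) G k) (cong (E *_) (CT⊕C-⊛ a b G k))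

open Arithmetic using (ℕ→ℚ-+; ℕ→ℚ-≡+; ℕ→ℚ-suc)
open Convolution using (merge-T)
open Recurrences using (first-order-identity; second-order-identity; even-contiguous; odd-contiguous)
open import Data.Nat using (_+_; _*_)

theorem2p5 : ((d : ℕ) → 2 ≤ d →
      ((C (ℕ→ℚ d) ⊛ T ⊕ C 1ℚ) ⊛ g (2 * d) d
        ≗ₚ C (ℕ→ℚ (d ∸ 1)) ⊛ T ⊛ g (2 * d ∸ 1) (d ∸ 1)
           ⊕ T ⊛ (T ⊕ C 1ℚ) ⊛ deriv (g (2 * d) d))
      × (C (ℕ→ℚ (d ∸ 1)) ⊛ (C (ℕ→ℚ d) ⊛ T ⊕ C (ℕ→ℚ (d + 1))) ⊛ g (2 * d) d
        ≗ₚ C (ℕ→ℚ (d ∸ 1)) ⊛ (C (ℕ→ℚ (2 * d ∸ 1)) ⊛ T ⊕ C (ℕ→ℚ (2 * d)))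
             ⊛ g (2 * d ∸ 1) (d ∸ 1)
           ⊕ T ⊛ (T ⊕ C 1ℚ) ⊛ (T ⊕ C 1ℚ) ⊛ deriv (deriv (g (2 * d) d))))
    ×
    ((d : ℕ) → 1 ≤ d →
      ((C (ℕ→ℚ (d + 1)) ⊛ T ⊕ C 1ℚ) ⊛ g (2 * d + 1) d
        ≗ₚ C (ℕ→ℚ d) ⊛ T ⊛ g (2 * d) d
           ⊕ T ⊛ (T ⊕ C 1ℚ) ⊛ deriv (g (2 * d + 1) d))
      × (C (ℕ→ℚ d) ⊛ (C (ℕ→ℚ d) ⊛ T ⊕ T ⊕ C (ℕ→ℚ (d + 2))) ⊛ g (2 * d + 1) d
        ≗ₚ C (ℕ→ℚ d) ⊛ (C (ℕ→ℚ (2 * d)) ⊛ T ⊕ C (ℕ→ℚ (2 * d + 1))) ⊛ g (2 * d) d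
           ⊕ T ⊛ (T ⊕ C 1ℚ) ⊛ (T ⊕ C 1ℚ) ⊛ deriv (deriv (g (2 * d + 1) d))))
theorem2p5 =
    (λ { zero ()
       ; (suc d) _ →
           first-order-identity (even-contiguous d) (ℕ→ℚ-suc d)
         , second-order-identity (even-contiguous d) (ℕ→ℚ-suc d) (ℕ→ℚ-≡+ d 2 (sym (ℕₚ.+-suc d 1)))
                                 (ℕ→ℚ-≡+ (suc d) d (2[1+d]∸1≡ d)) (ℕ→ℚ-suc (2 * suc d ∸ 1)) })
  , (λ d _ →
         first-order-identity (odd-contiguous d) (ℕ→ℚ-+ d 1)
       , λ k → trans (merge-T (ℕ→ℚ d) (ℕ→ℚ d) (ℕ→ℚ (d + 2)) (g (2 * d + 1) d) k)
                     (second-order-identity (odd-contiguous d) refl (ℕ→ℚ-+ d 2)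
                                            (ℕ→ℚ-≡+ d d (2d≡d+d d)) (ℕ→ℚ-+ (2 * d) 1) k))
  where
  2[1+d]∸1≡ : ∀ d → 2 * suc d ∸ 1 ≡ suc d + d
  2[1+d]∸1≡ d = trans (ℕₚ.+-suc d (d + 0)) (cong (λ m → suc (d + m)) (ℕₚ.+-identityʳ d))
  2d≡d+d : ∀ d → 2 * d ≡ d + d
  2d≡d+d d = cong (d +_) (ℕₚ.+-identityʳ d)
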